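{- Let $G=G_1\times G_2$ be the direct product of two finite commutative groups, and let $A=A_1\times A_2$, where $A_1\subset G_1$ and $A_2\subset G_2$ are standard sets. Then \[ \overline\delta(A)=\overline\delta(A_1)\,\overline\delta(A_2)\quad\text{and}\quad \delta(A_1)\delta(A_2)\le\delta(A)\le\delta(A_1)\,\overline\delta(A_2). \]
   Context: Groups are written additively. For a finite commutative group $H$, a set $A\subset H$ is a standard set if $A=-A$ and $0\in A$; then $\Delta(A)=\max\{|B|:B\subset H,\ (B-B)\cap A=\{0\}\}$, $\delta(A)=\Delta(A)/|H|$, $\overline\Delta(A)=\max\{|B|:B\subset H,\ B-B\subset A\}$, $\overline\delta(A)=1/\overline\Delta(A)$. For $A_i$ these are computed in $G_i$, for $A$ in $G$. -}

module Defs where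

open import Level using (0ℓ)
open import Data.Nat using (ℕ; zero; suc; _≤_)
open import Data.Integer using (+_)
open import Data.Rational using (ℚ; 0ℚ; _/_)
open import Data.Product using (Σ; ∃; _×_; _,_)
open import Data.List using (List; length; cartesianProduct)
open import Data.List.Membership.Propositional using (_∈_)
open import Data.List.Relation.Unary.Unique.Propositional using (Unique)
open import Relation.Unary using (Pred)
open import Relation.Binary.PropositionalEquality using (_≡_)
open import Algebra.Structures using (IsAbelianGroup)

record RawFinGroup : Set₁ where
  field
    Carrier : Set
    _+_     : Carrier → Carrier → Carrier
    0#      : Carrier
    -_      : Carrier → Carrier
    elems   : List Carrier

  _-_ : Carrier → Carrier → Carrier
  x - y = x + (- y)

  order : ℕ
  order = length elems

record FinAbGroup : Set₁ where
  field
    raw : RawFinGroup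
  open RawFinGroup raw public
  field
    isAbelianGroup : IsAbelianGroup _≡_ _+_ 0# (λ x → - x)
    complete       : ∀ x → x ∈ elems
    unique         : Unique elems

_×ᴿ_ : RawFinGroup → RawFinGroup → RawFinGroup
G₁ ×ᴿ G₂ = record
  { Carrier = G₁.Carrier × G₂.Carrier
  ; _+_     = λ { (a , b) (c , d) → (a G₁.+ c) , (b G₂.+ d) }
  ; 0#      = G₁.0# , G₂.0#
  ; -_      = λ { (a , b) → (G₁.- a) , (G₂.- b) }
  ; elems   = cartesianProduct G₁.elems G₂.elems
  }
  where
    module G₁ = RawFinGroup G₁
    module G₂ = RawFinGroup G₂

_×ˢ_ : {X Y : Set} → Pred X 0ℓ → Pred Y 0ℓ → Pred (X × Y) 0ℓ
(A₁ ×ˢ A₂) (x , y) = A₁ x × A₂ y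

module _ (H : RawFinGroup) where
  open RawFinGroup H

  IsStandard : Pred Carrier 0ℓ → Set
  IsStandard A = (A 0#) × (∀ x → A x → A (- x)) × (∀ x → A (- x) → A x)

  -- (B - B) ∩ A = {0}  (B a finite subset, given as a duplicate-free list)
  DiffMeetsOnlyZero : Pred Carrier 0ℓ → List Carrier → Set
  DiffMeetsOnlyZero A B = ∀ b b′ → b ∈ B → b′ ∈ B → A (b - b′) → b - b′ ≡ 0#

  DiffInside : Pred Carrier 0ℓ → List Carrier → Set
  DiffInside A B = ∀ b b′ → b ∈ B → b′ ∈ B → A (b - b′)

  IsMaxCard : (List Carrier → Set) → ℕ → Set
  IsMaxCard P k =
    (Σ (List Carrier) λ B → Unique B × P B × length B ≡ k)
    × (∀ B → Unique B → P B → length B ≤ k)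

  IsΔ : Pred Carrier 0ℓ → ℕ → Set
  IsΔ A = IsMaxCard (DiffMeetsOnlyZero A)

  IsΔbar : Pred Carrier 0ℓ → ℕ → Set
  IsΔbar A = IsMaxCard (DiffInside A)

-- the rational number k / n  (only used with n ≥ 1; returns 0 for n = 0)
frac : ℕ → ℕ → ℚ
frac k zero    = 0ℚ
frac k (suc n) = (+ k) / suc n

module Submission where

-- Both Δ̄ and Δ are squeezed between a product construction and a counting
-- argument over fibres. Lower bounds: if B₁, B₂ are admissible for A₁, A₂,
-- then so is B₁ × B₂ for A₁ × A₂. Upper bound for Δ̄: a set B with
-- B − B ⊂ A₁ × A₂ projects onto a set K₁ with K₁ − K₁ ⊂ A₁, and each fibre
-- of this projection is, in the second coordinate, a set whose differences
-- lie in A₂; so |B| ≤ Δ̄(A₁) Δ̄(A₂). Upper bound for Δ: take B optimal for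
-- A₁ × A₂ and C optimal for Δ̄(A₂), and sort the |B| |C| triples
-- ((x , y) , c) by y + c ∈ G₂. Two triples in one fibre have
-- y − y′ = c′ − c ∈ A₂, so on a fibre x determines the triple and the first
-- coordinates form a set whose differences meet A₁ only in 0. Hence
-- |B| |C| ≤ |G₂| Δ(A₁).

open import Defs
open import Level using (0ℓ)
open import Algebra.Bundles using (AbelianGroup)
open import Data.Fin.Properties using () renaming (_≟_ to _≟ᶠ_)
import Data.Integer as ℤ
open import Data.Integer.Properties using (pos-*)
open import Data.List using (List; []; _∷_; length; map; filter; cartesianProduct; deduplicate; lookup)
open import Data.List.Properties using (length-++; length-map)
open import Data.List.Membership.Propositional using (_∈_)
open import Data.List.Membership.Propositional.Properties
  using (∈-filter⁻; ∈-map⁺; ∈-map⁻; ∈-cartesianProduct⁻; ∈-deduplicate⁺; ∈-deduplicate⁻)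
open import Data.List.Relation.Binary.Subset.Propositional using (_⊆_)
open import Data.List.Relation.Unary.All as All using ([])
import Data.List.Relation.Unary.All.Properties as All
open import Data.List.Relation.Unary.AllPairs using ([]; _∷_)
open import Data.List.Relation.Unary.Any using (here; there; index)
open import Data.List.Relation.Unary.Any.Properties using (lookup-index)
open import Data.List.Relation.Unary.Unique.Propositional using (Unique)
import Data.List.Relation.Unary.Unique.Propositional.Properties as Unique
import Data.List.Relation.Unary.Unique.DecPropositional.Properties as UniqueDec
open import Data.Nat as ℕ using (ℕ; suc; _<_; z≤n; s≤s)
import Data.Nat.Properties as ℕ
open import Data.Nat.Tactic.RingSolver using (solve-∀)
open import Data.Product using (_×_; _,_; proj₁; proj₂)
open import Data.Rational as ℚ using (_*_; _≤_)
import Data.Rational.Properties as ℚ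
open import Data.Rational.Unnormalised as ℚᵘ using (mkℚᵘ; *≤*; *≡*)
import Data.Rational.Unnormalised.Properties as ℚᵘ
open import Function using (_∘_)
open import Relation.Binary.Definitions using (DecidableEquality)
open import Relation.Binary.PropositionalEquality
open import Relation.Nullary using (yes; no)
open import Relation.Nullary.Decidable using (map′)
open import Relation.Nullary.Negation using (contradiction)
open import Relation.Unary using (Pred; Decidable)
open import Relation.Unary.Properties using (∁?)

module _ {X : Set} where

  ≡-dec-fromEnumeration : (xs : List X) → (∀ x → x ∈ xs) → DecidableEquality X
  ≡-dec-fromEnumeration xs ∈xs x y =
    map′ sameIndex⇒≡ (cong (index ∘ ∈xs)) (index (∈xs x) ≟ᶠ index (∈xs y))
    where
    sameIndex⇒≡ : index (∈xs x) ≡ index (∈xs y) → x ≡ y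
    sameIndex⇒≡ eq = trans (lookup-index (∈xs x))
                       (trans (cong (lookup xs) eq) (sym (lookup-index (∈xs y))))

  length-filter-∁ : {P : Pred X 0ℓ} (P? : Decidable P) (xs : List X) →
    length xs ≡ length (filter P? xs) ℕ.+ length (filter (∁? P?) xs)
  length-filter-∁ P? [] = refl
  length-filter-∁ P? (x ∷ xs) with P? x
  ... | yes _ = cong suc (length-filter-∁ P? xs)
  ... | no _  = trans (cong suc (length-filter-∁ P? xs)) (sym (ℕ.+-suc _ _))

  map⁺-injectiveOn : {Y : Set} {f : X → Y} {xs : List X} →
    (∀ {x x′} → x ∈ xs → x′ ∈ xs → f x ≡ f x′ → x ≡ x′) → Unique xs → Unique (map f xs)
  map⁺-injectiveOn inj [] = []
  map⁺-injectiveOn inj (x∉xs ∷ xs!) =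
    All.map⁺ (All.tabulate λ x′∈xs fx≡fx′ → All.lookup x∉xs x′∈xs (inj (here refl) (there x′∈xs) fx≡fx′))
    ∷ map⁺-injectiveOn (λ p q → inj (there p) (there q)) xs!

  length-cartesianProduct : {Y : Set} (xs : List X) (ys : List Y) →
    length (cartesianProduct xs ys) ≡ length xs ℕ.* length ys
  length-cartesianProduct [] ys = refl
  length-cartesianProduct (x ∷ xs) ys =
    trans (length-++ (map (x ,_) ys))
          (cong₂ ℕ._+_ (length-map (x ,_) ys) (length-cartesianProduct xs ys))

module _ {X Y : Set} where

  FibresBoundedBy : (X → Y) → ℕ → List X → Set
  FibresBoundedBy f m L = ∀ S → Unique S → S ⊆ L →
    (∀ {x x′} → x ∈ S → x′ ∈ S → f x ≡ f x′) → length S ℕ.≤ m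

  length≤length*fibreBound : DecidableEquality Y → (f : X → Y) {m : ℕ} (K : List Y) {L : List X} →
    Unique L → (∀ {x} → x ∈ L → f x ∈ K) → FibresBoundedBy f m L → length L ℕ.≤ length K ℕ.* m
  length≤length*fibreBound _≟_ f [] {[]} _ _ _ = z≤n
  length≤length*fibreBound _≟_ f [] {x ∷ L} _ f∈K _ with () ← f∈K (here refl)
  length≤length*fibreBound _≟_ f {m} (y ∷ K) {L} L! f∈K fibres = begin
    length L                                  ≡⟨ length-filter-∁ over? L ⟩
    length (filter over? L) ℕ.+ length (filter (∁? over?) L)
                                              ≤⟨ ℕ.+-mono-≤ fibre-y rest ⟩
    m ℕ.+ length K ℕ.* m                      ∎
    where
    open ℕ.≤-Reasoning
    over? : Decidable (λ x → f x ≡ y)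
    over? x = f x ≟ y
    fibre-y : length (filter over? L) ℕ.≤ m
    fibre-y = fibres _ (Unique.filter⁺ over? L!) (proj₁ ∘ ∈-filter⁻ over? {xs = L})
      λ p q → trans (proj₂ (∈-filter⁻ over? {xs = L} p)) (sym (proj₂ (∈-filter⁻ over? {xs = L} q)))
    f∈K′ : ∀ {x} → x ∈ filter (∁? over?) L → f x ∈ K
    f∈K′ p with ∈-filter⁻ (∁? over?) {xs = L} p
    ... | x∈L , fx≢y with f∈K x∈L
    ...   | here fx≡y = contradiction fx≡y fx≢y
    ...   | there fx∈K = fx∈K
    rest : length (filter (∁? over?) L) ℕ.≤ length K ℕ.* m
    rest = length≤length*fibreBound _≟_ f K (Unique.filter⁺ (∁? over?) L!) f∈K′
      λ S S! S⊆ → fibres S S! (proj₁ ∘ ∈-filter⁻ (∁? over?) {xs = L} ∘ S⊆)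

module _ where
  open ℤ using (+_; +≤+)

  toℚᵘ-frac : ∀ a m → ℚ.toℚᵘ (frac a (suc m)) ℚᵘ.≃ mkℚᵘ (+ a) m
  toℚᵘ-frac a m = ℚ.toℚᵘ-fromℚᵘ (mkℚᵘ (+ a) m)

  frac-* : ∀ a b {m n} → 0 < m → 0 < n → frac a m * frac b n ≡ frac (a ℕ.* b) (m ℕ.* n)
  frac-* a b {suc m} {suc n} _ _ = ℚ.toℚᵘ-injective (begin
    ℚ.toℚᵘ (frac a (suc m) * frac b (suc n))
      ≈⟨ ℚ.toℚᵘ-homo-* (frac a (suc m)) (frac b (suc n)) ⟩
    ℚ.toℚᵘ (frac a (suc m)) ℚᵘ.* ℚ.toℚᵘ (frac b (suc n))
      ≈⟨ ℚᵘ.*-cong (toℚᵘ-frac a m) (toℚᵘ-frac b n) ⟩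
    mkℚᵘ (+ a ℤ.* + b) mn
      ≈⟨ *≡* (cong (ℤ._* + suc mn) (sym (pos-* a b))) ⟩
    mkℚᵘ (+ (a ℕ.* b)) mn
      ≈⟨ ℚᵘ.≃-sym (toℚᵘ-frac (a ℕ.* b) mn) ⟩
    ℚ.toℚᵘ (frac (a ℕ.* b) (suc m ℕ.* suc n)) ∎)
    where
    open ℚᵘ.≃-Reasoning
    mn : ℕ
    mn = n ℕ.+ m ℕ.* suc n

  frac-≤ : ∀ {a b m n} → 0 < m → 0 < n → a ℕ.* n ℕ.≤ b ℕ.* m → frac a m ≤ frac b n
  frac-≤ {a} {b} {suc m} {suc n} _ _ an≤bm = ℚ.toℚᵘ-cancel-≤
    (ℚᵘ.≤-respˡ-≃ (ℚᵘ.≃-sym (toℚᵘ-frac a m)) (ℚᵘ.≤-respʳ-≃ (ℚᵘ.≃-sym (toℚᵘ-frac b n))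
      (*≤* (subst₂ ℤ._≤_ (pos-* a (suc n)) (pos-* b (suc m)) (+≤+ an≤bm)))))

frac-*-≤ : ∀ {a b c m n} → 0 < m → 0 < n → a ℕ.* b ℕ.≤ c → frac a m * frac b n ≤ frac c (m ℕ.* n)
frac-*-≤ {a} {b} {c} {m} {n} 0<m 0<n ab≤c = begin
  frac a m * frac b n        ≡⟨ frac-* a b 0<m 0<n ⟩
  frac (a ℕ.* b) (m ℕ.* n)   ≤⟨ frac-≤ 0<mn 0<mn (ℕ.*-monoˡ-≤ (m ℕ.* n) ab≤c) ⟩
  frac c (m ℕ.* n)           ∎
  where
  open ℚ.≤-Reasoning
  0<mn : 0 < m ℕ.* n
  0<mn = ℕ.*-mono-< 0<m 0<n

frac-≤-*-frac1 : ∀ {a c m n l} → 0 < m → 0 < n → 0 < l → c ℕ.* l ℕ.≤ n ℕ.* a →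
  frac c (m ℕ.* n) ≤ frac a m * frac 1 l
frac-≤-*-frac1 {a} {c} {m} {n} {l} 0<m 0<n 0<l cl≤na =
  subst (frac c (m ℕ.* n) ≤_) (sym (frac-* a 1 0<m 0<l))
    (frac-≤ (ℕ.*-mono-< 0<m 0<n) (ℕ.*-mono-< 0<m 0<l) cross-multiplied)
  where
  open ℕ.≤-Reasoning
  cross-multiplied : c ℕ.* (m ℕ.* l) ℕ.≤ a ℕ.* 1 ℕ.* (m ℕ.* n)
  cross-multiplied = begin
    c ℕ.* (m ℕ.* l)       ≡⟨ swap c m l ⟩
    m ℕ.* (c ℕ.* l)       ≤⟨ ℕ.*-monoʳ-≤ m cl≤na ⟩
    m ℕ.* (n ℕ.* a)       ≡⟨ regroup m n a ⟩
    a ℕ.* 1 ℕ.* (m ℕ.* n) ∎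
    where
    swap : ∀ x y z → x ℕ.* (y ℕ.* z) ≡ y ℕ.* (x ℕ.* z)
    swap = solve-∀
    regroup : ∀ x y z → x ℕ.* (y ℕ.* z) ≡ z ℕ.* 1 ℕ.* (x ℕ.* y)
    regroup = solve-∀

module FinAbGroupProperties (G : FinAbGroup) where
  open FinAbGroup G public

  abelianGroup : AbelianGroup 0ℓ 0ℓ
  abelianGroup = record { isAbelianGroup = isAbelianGroup }

  open AbelianGroup abelianGroup using (assoc; comm; inverseʳ)
  open import Algebra.Properties.AbelianGroup abelianGroup
    using (x∙y⁻¹≈ε⇒x≈y; xyx⁻¹≈y; x≈z//y) renaming (∙-cancelˡ to +-cancelˡ) public

  _≟_ : DecidableEquality Carrier
  _≟_ = ≡-dec-fromEnumeration elems complete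

  0<order : 0 < order
  0<order with elems | complete 0#
  ... | _ ∷ _ | _ = s≤s z≤n

  x-x≡0 : ∀ x → x - x ≡ 0#
  x-x≡0 = inverseʳ

  x-y≡0⇒x≡y : ∀ {x y} → x - y ≡ 0# → x ≡ y
  x-y≡0⇒x≡y = x∙y⁻¹≈ε⇒x≈y _ _

  x+y≡u+v⇒x-u≡v-y : ∀ {x y u v} → x + y ≡ u + v → x - u ≡ v - y
  x+y≡u+v⇒x-u≡v-y {x} {y} {u} {v} eq = x≈z//y (x - u) y v (begin
    (x - u) + y     ≡⟨ assoc x (- u) y ⟩
    x + ((- u) + y) ≡⟨ cong (x +_) (comm (- u) y) ⟩
    x + (y - u)     ≡⟨ assoc x y (- u) ⟨
    (x + y) - u     ≡⟨ cong (_- u) eq ⟩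
    (u + v) - u     ≡⟨ xyx⁻¹≈y u v ⟩
    v               ∎)
    where open ≡-Reasoning

  0<Δ̄ : ∀ (A : Pred Carrier 0ℓ) {k} → A 0# → IsΔbar raw A k → 0 < k
  0<Δ̄ A A0 (_ , maximal) = maximal (0# ∷ []) ([] ∷ []) singleton
    where
    singleton : DiffInside raw A (0# ∷ [])
    singleton _ _ (here refl) (here refl) = subst A (sym (x-x≡0 0#)) A0

IsMaxCard-cartesianProduct-≤ : ∀ H₁ H₂ {P₁ P₂ P k₁ k₂ k} →
  IsMaxCard H₁ P₁ k₁ → IsMaxCard H₂ P₂ k₂ → IsMaxCard (H₁ ×ᴿ H₂) P k →
  (∀ {B₁ B₂} → P₁ B₁ → P₂ B₂ → P (cartesianProduct B₁ B₂)) → k₁ ℕ.* k₂ ℕ.≤ k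
IsMaxCard-cartesianProduct-≤ _ _ ((B₁ , B₁! , P₁B₁ , refl) , _) ((B₂ , B₂! , P₂B₂ , refl) , _) (_ , maximal) P× =
  subst (ℕ._≤ _) (length-cartesianProduct B₁ B₂)
    (maximal _ (Unique.cartesianProduct⁺ B₁! B₂!) (P× P₁B₁ P₂B₂))

module _ (H₁ H₂ : RawFinGroup)
         (A₁ : Pred (RawFinGroup.Carrier H₁) 0ℓ) (A₂ : Pred (RawFinGroup.Carrier H₂) 0ℓ) where

  DiffInside-cartesianProduct : ∀ {B₁ B₂} → DiffInside H₁ A₁ B₁ → DiffInside H₂ A₂ B₂ →
    DiffInside (H₁ ×ᴿ H₂) (A₁ ×ˢ A₂) (cartesianProduct B₁ B₂)
  DiffInside-cartesianProduct {B₁} {B₂} d₁ d₂ (x , y) (x′ , y′) p p′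
    with ∈-cartesianProduct⁻ B₁ B₂ p | ∈-cartesianProduct⁻ B₁ B₂ p′
  ... | x∈B₁ , y∈B₂ | x′∈B₁ , y′∈B₂ = d₁ x x′ x∈B₁ x′∈B₁ , d₂ y y′ y∈B₂ y′∈B₂

  DiffMeetsOnlyZero-cartesianProduct : ∀ {B₁ B₂} →
    DiffMeetsOnlyZero H₁ A₁ B₁ → DiffMeetsOnlyZero H₂ A₂ B₂ →
    DiffMeetsOnlyZero (H₁ ×ᴿ H₂) (A₁ ×ˢ A₂) (cartesianProduct B₁ B₂)
  DiffMeetsOnlyZero-cartesianProduct {B₁} {B₂} d₁ d₂ (x , y) (x′ , y′) p p′ (a₁ , a₂)
    with ∈-cartesianProduct⁻ B₁ B₂ p | ∈-cartesianProduct⁻ B₁ B₂ p′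
  ... | x∈B₁ , y∈B₂ | x′∈B₁ , y′∈B₂ = cong₂ _,_ (d₁ x x′ x∈B₁ x′∈B₁ a₁) (d₂ y y′ y∈B₂ y′∈B₂ a₂)

  Δ̄-cartesianProduct-≥ : ∀ {k₁ k₂ k} → IsΔbar H₁ A₁ k₁ → IsΔbar H₂ A₂ k₂ →
    IsΔbar (H₁ ×ᴿ H₂) (A₁ ×ˢ A₂) k → k₁ ℕ.* k₂ ℕ.≤ k
  Δ̄-cartesianProduct-≥ d₁ d₂ d = IsMaxCard-cartesianProduct-≤ H₁ H₂ d₁ d₂ d DiffInside-cartesianProduct

  Δ-cartesianProduct-≥ : ∀ {k₁ k₂ k} → IsΔ H₁ A₁ k₁ → IsΔ H₂ A₂ k₂ →
    IsΔ (H₁ ×ᴿ H₂) (A₁ ×ˢ A₂) k → k₁ ℕ.* k₂ ℕ.≤ k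
  Δ-cartesianProduct-≥ d₁ d₂ d = IsMaxCard-cartesianProduct-≤ H₁ H₂ d₁ d₂ d DiffMeetsOnlyZero-cartesianProduct

  Δ̄-cartesianProduct-≤ : ∀ {k₁ k₂ k} → DecidableEquality (RawFinGroup.Carrier H₁) →
    IsΔbar H₁ A₁ k₁ → IsΔbar H₂ A₂ k₂ →
    IsΔbar (H₁ ×ᴿ H₂) (A₁ ×ˢ A₂) k → k ℕ.≤ k₁ ℕ.* k₂
  Δ̄-cartesianProduct-≤ {k₁} {k₂} _≟_ (_ , maximal₁) (_ , maximal₂) ((B , B! , B-B⊆A , refl) , _) =
    ℕ.≤-trans (length≤length*fibreBound _≟_ proj₁ K₁ B! (∈-deduplicate⁺ _≟_ ∘ ∈-map⁺ proj₁) fibres)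
              (ℕ.*-monoˡ-≤ k₂ |K₁|≤k₁)
    where
    K₁ : List (RawFinGroup.Carrier H₁)
    K₁ = deduplicate _≟_ (map proj₁ B)
    K₁-K₁⊆A₁ : DiffInside H₁ A₁ K₁
    K₁-K₁⊆A₁ _ _ p p′ with ∈-map⁻ proj₁ (∈-deduplicate⁻ _≟_ (map proj₁ B) p)
                         | ∈-map⁻ proj₁ (∈-deduplicate⁻ _≟_ (map proj₁ B) p′)
    ... | b , b∈B , refl | b′ , b′∈B , refl = proj₁ (B-B⊆A b b′ b∈B b′∈B)
    |K₁|≤k₁ : length K₁ ℕ.≤ k₁
    |K₁|≤k₁ = maximal₁ K₁ (UniqueDec.deduplicate-! _≟_ (map proj₁ B)) K₁-K₁⊆A₁
    fibres : FibresBoundedBy proj₁ k₂ B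
    fibres S S! S⊆B same = subst (ℕ._≤ k₂) (length-map proj₂ S)
      (maximal₂ (map proj₂ S) (map⁺-injectiveOn (λ p q → cong₂ _,_ (same p q)) S!) S₂-S₂⊆A₂)
      where
      S₂-S₂⊆A₂ : DiffInside H₂ A₂ (map proj₂ S)
      S₂-S₂⊆A₂ _ _ p p′ with ∈-map⁻ proj₂ p | ∈-map⁻ proj₂ p′
      ... | s , s∈S , refl | s′ , s′∈S , refl = proj₂ (B-B⊆A s s′ (S⊆B s∈S) (S⊆B s′∈S))

module _ (G₁ G₂ : FinAbGroup)
         (A₁ : Pred (FinAbGroup.Carrier G₁) 0ℓ) (A₂ : Pred (FinAbGroup.Carrier G₂) 0ℓ) where
  private
    module G₁ = FinAbGroupProperties G₁
    module G₂ = FinAbGroupProperties G₂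

  Δ-cartesianProduct-*-Δ̄-≤ : ∀ {k₁ l₂ k} → A₁ G₁.0# → IsΔ G₁.raw A₁ k₁ → IsΔbar G₂.raw A₂ l₂ →
    IsΔ (G₁.raw ×ᴿ G₂.raw) (A₁ ×ˢ A₂) k → k ℕ.* l₂ ℕ.≤ G₂.order ℕ.* k₁
  Δ-cartesianProduct-*-Δ̄-≤ {k₁} A₁0 (_ , maximal₁) ((C , C! , C-C⊆A₂ , refl) , _) ((B , B! , B-B∩A , refl) , _) =
    subst (ℕ._≤ _) (length-cartesianProduct B C)
      (length≤length*fibreBound G₂._≟_ sum G₂.elems (Unique.cartesianProduct⁺ B! C!)
        (λ {t} _ → G₂.complete (sum t)) fibres)
    where
    sum : (G₁.Carrier × G₂.Carrier) × G₂.Carrier → G₂.Carrier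
    sum ((_ , y) , c) = y G₂.+ c
    first : (G₁.Carrier × G₂.Carrier) × G₂.Carrier → G₁.Carrier
    first = proj₁ ∘ proj₁
    fibres : FibresBoundedBy sum k₁ (cartesianProduct B C)
    fibres S S! S⊆BC same =
      subst (ℕ._≤ k₁) (length-map first S) (maximal₁ (map first S) (map⁺-injectiveOn injective S!) diffs)
      where
      A₁⇒samePoint : ∀ {s s′} → s ∈ S → s′ ∈ S → A₁ (first s G₁.- first s′) → proj₁ s ≡ proj₁ s′
      A₁⇒samePoint {(x , y) , c} {(x′ , y′) , c′} p p′ a₁
        with ∈-cartesianProduct⁻ B C (S⊆BC p) | ∈-cartesianProduct⁻ B C (S⊆BC p′)
      ... | xy∈B , c∈C | x′y′∈B , c′∈C =
        cong₂ _,_ (G₁.x-y≡0⇒x≡y (cong proj₁ diff≡0)) (G₂.x-y≡0⇒x≡y (cong proj₂ diff≡0))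
        where
        a₂ : A₂ (y G₂.- y′)
        a₂ = subst A₂ (sym (G₂.x+y≡u+v⇒x-u≡v-y (same p p′))) (C-C⊆A₂ c′ c c′∈C c∈C)
        diff≡0 : (x G₁.- x′ , y G₂.- y′) ≡ (G₁.0# , G₂.0#)
        diff≡0 = B-B∩A (x , y) (x′ , y′) xy∈B x′y′∈B (a₁ , a₂)
      injective : ∀ {s s′} → s ∈ S → s′ ∈ S → first s ≡ first s′ → s ≡ s′
      injective {(x , y) , c} {_ , c′} p p′ refl
        with refl ← A₁⇒samePoint p p′ (subst A₁ (sym (G₁.x-x≡0 x)) A₁0)
        = cong ((x , y) ,_) (G₂.+-cancelˡ y c c′ (same p p′))
      diffs : DiffMeetsOnlyZero G₁.raw A₁ (map first S)
      diffs _ _ p p′ a₁ with ∈-map⁻ first p | ∈-map⁻ first p′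
      ... | s , s∈S , refl | s′ , s′∈S , refl =
        trans (cong (λ t → proj₁ t G₁.- first s′) (A₁⇒samePoint s∈S s′∈S a₁)) (G₁.x-x≡0 (first s′))

theorem8p2 : (G₁ G₂ : FinAbGroup) →
    (A₁ : Pred (FinAbGroup.Carrier G₁) 0ℓ) → (A₂ : Pred (FinAbGroup.Carrier G₂) 0ℓ) →
    IsStandard (FinAbGroup.raw G₁) A₁ → IsStandard (FinAbGroup.raw G₂) A₂ →
    (Δ₁ Δ₂ Δ Δ̄₁ Δ̄₂ Δ̄ : ℕ) →
    IsΔ (FinAbGroup.raw G₁) A₁ Δ₁ → IsΔ (FinAbGroup.raw G₂) A₂ Δ₂ →
    IsΔ (FinAbGroup.raw G₁ ×ᴿ FinAbGroup.raw G₂) (A₁ ×ˢ A₂) Δ →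
    IsΔbar (FinAbGroup.raw G₁) A₁ Δ̄₁ → IsΔbar (FinAbGroup.raw G₂) A₂ Δ̄₂ →
    IsΔbar (FinAbGroup.raw G₁ ×ᴿ FinAbGroup.raw G₂) (A₁ ×ˢ A₂) Δ̄ →
    let n₁ = FinAbGroup.order G₁
        n₂ = FinAbGroup.order G₂
        n  = RawFinGroup.order (FinAbGroup.raw G₁ ×ᴿ FinAbGroup.raw G₂)
    in (frac 1 Δ̄ ≡ frac 1 Δ̄₁ * frac 1 Δ̄₂)
       × (frac Δ₁ n₁ * frac Δ₂ n₂ ≤ frac Δ n)
       × (frac Δ n ≤ frac Δ₁ n₁ * frac 1 Δ̄₂)
theorem8p2 G₁ G₂ A₁ A₂ (A₁0 , _) (A₂0 , _) Δ₁ Δ₂ Δ Δ̄₁ Δ̄₂ Δ̄ d₁ d₂ d d̄₁ d̄₂ d̄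
  rewrite length-cartesianProduct (FinAbGroup.elems G₁) (FinAbGroup.elems G₂) =
    trans (cong (frac 1) Δ̄≡Δ̄₁*Δ̄₂) (sym (frac-* 1 1 (G₁.0<Δ̄ A₁ A₁0 d̄₁) 0<Δ̄₂))
  , frac-*-≤ G₁.0<order G₂.0<order (Δ-cartesianProduct-≥ G₁.raw G₂.raw A₁ A₂ d₁ d₂ d)
  , frac-≤-*-frac1 G₁.0<order G₂.0<order 0<Δ̄₂ (Δ-cartesianProduct-*-Δ̄-≤ G₁ G₂ A₁ A₂ A₁0 d₁ d̄₂ d)
  where
  module G₁ = FinAbGroupProperties G₁
  module G₂ = FinAbGroupProperties G₂
  0<Δ̄₂ : 0 < Δ̄₂
  0<Δ̄₂ = G₂.0<Δ̄ A₂ A₂0 d̄₂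
  Δ̄≡Δ̄₁*Δ̄₂ : Δ̄ ≡ Δ̄₁ ℕ.* Δ̄₂
  Δ̄≡Δ̄₁*Δ̄₂ = ℕ.≤-antisym (Δ̄-cartesianProduct-≤ G₁.raw G₂.raw A₁ A₂ G₁._≟_ d̄₁ d̄₂ d̄)
                         (Δ̄-cartesianProduct-≥ G₁.raw G₂.raw A₁ A₂ d̄₁ d̄₂ d̄)
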